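{- A permutation $\pi$ is sorted by the algorithm described below (i.e., the algorithm run on input $\pi$ produces the output $12\cdots n$) if and only if $\pi$ avoids both patterns $3142$ and $3241$. In other words, the class of permutations sortable by DI using this algorithm has basis $\{3142,3241\}$. The algorithm repeatedly performs the first applicable of the following rules: (1) if the top entry of I is the next entry to be output, move it to the output; (2) if the $m$ entries currently in D are exactly the next $m$ entries to be output, move them (one at a time, from the top of D) to I; (3) otherwise, if the next entry of the input is smaller than the top entry of I (or I is empty) and larger than the top entry of D (or D is empty), push it onto D; (4) otherwise, move the top entry of D to I. The algorithm fails on $\pi$ if it reaches a situation in which it cannot produce the output $12\cdots n$ by these rules.
   Context: The DI machine consists of two stacks in series: a decreasing stack D followed by an increasing stack I. A permutation $\pi=\pi(1)\cdots\pi(n)$ is processed from left to right, and the allowed moves are: push the next unread input entry onto the top of D; move the top entry of D onto the top of I; move the top entry of I to the end of the output. The entries of D must be decreasing when read from top to bottom (an entry may be placed on D only if it exceeds D's current top entry, or D is empty), and the entries of I must be increasing when read from top to bottom (an entry may be placed on I only if it is smaller than I's current top entry, or I is empty). The output is read left to right and the goal is to output $12\cdots n$. A permutation $\pi$ contains a pattern $\sigma$ of length $k$ if some subsequence of $\pi$ of length $k$ is order-isomorphic to $\sigma$; otherwise $\pi$ avoids $\sigma$. The basis of a permutation class (a set closed under pattern containment) is the set of minimal permutations (under containment) not in the class. -}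

module Defs where

open import Data.Nat using (ℕ; zero; suc; _+_; _<_; _<ᵇ_; _≡ᵇ_)
open import Data.Nat.Properties using (_≟_)
open import Data.Bool using (Bool; true; false; if_then_else_; _∧_)
open import Data.List using (List; []; _∷_; length; applyUpTo; reverse; lookup)
open import Data.List.Properties using (≡-dec)
open import Data.List.Relation.Binary.Sublist.Propositional using (_⊆_)
open import Data.List.Relation.Binary.Permutation.Propositional using (_↭_)
open import Data.Maybe using (Maybe; just; nothing; _>>=_)
open import Data.Fin using (Fin; cast)
open import Data.Product using (Σ; ∃; _×_; _,_)
open import Relation.Binary.PropositionalEquality using (_≡_; sym)
open import Relation.Nullary using (yes; no)
open import Function.Bundles using (_⇔_)

identityPerm : ℕ → List ℕ
identityPerm n = applyUpTo suc n

IsPerm : List ℕ → Set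
IsPerm π = π ↭ identityPerm (length π)

OrderIso : List ℕ → List ℕ → Set
OrderIso τ σ =
  Σ (length τ ≡ length σ) λ eq →
    (i j : Fin (length σ)) →
      (lookup τ (cast (sym eq) i) < lookup τ (cast (sym eq) j)) ⇔ (lookup σ i < lookup σ j)

Contains : List ℕ → List ℕ → Set
Contains π σ = ∃ λ τ → τ ⊆ π × OrderIso τ σ

Avoids : List ℕ → List ℕ → Set
Avoids π σ = Contains π σ → Data.Empty.⊥
  where import Data.Empty

-- Stacks are lists with the head being the top entry.
-- D must be decreasing from top to bottom (a new entry must exceed the top),
-- I must be increasing from top to bottom (a new entry must be below the top).

record State : Set where
  constructor st
  field
    input  : List ℕ
    D      : List ℕ
    I      : List ℕ
    output : List ℕ   -- output read left to right

open State public

canPushI : ℕ → List ℕ → Bool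
canPushI x []      = true
canPushI x (y ∷ _) = x <ᵇ y

canPushD : ℕ → List ℕ → Bool
canPushD x []      = true
canPushD x (y ∷ _) = y <ᵇ x

moveAll : List ℕ → List ℕ → Maybe (List ℕ)
moveAll []      I = just I
moveAll (x ∷ D) I = if canPushI x I then moveAll D (x ∷ I) else nothing

-- the next entry to be output (entries are 1..n)
nextOut : State → ℕ
nextOut s = suc (length (output s))

-- the next m entries to be output, listed as they sit in a decreasing
-- stack read from the top: next+m-1, ..., next+1, next
nextBlock : ℕ → ℕ → List ℕ
nextBlock nxt m = reverse (applyUpTo (nxt +_) m)

-- one step of the algorithm: apply the first applicable rule.
-- nothing = no rule applies / the prescribed move is illegal (halt).
rule4 : State → Maybe State
rule4 (st inp [] I out)      = nothing
rule4 (st inp (x ∷ D) I out) =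
  if canPushI x I then just (st inp D (x ∷ I) out) else nothing

rule3 : State → Maybe State
rule3 s@(st [] D I out)        = rule4 s
rule3 s@(st (x ∷ inp) D I out) =
  if canPushI x I ∧ canPushD x D then just (st inp (x ∷ D) I out) else rule4 s

rule2 : State → Maybe State
rule2 s@(st inp [] I out)      = rule3 s
rule2 s@(st inp (d ∷ D) I out) with ≡-dec _≟_ (d ∷ D) (nextBlock (nextOut s) (length (d ∷ D)))
... | yes _ = moveAll (d ∷ D) I >>= λ I′ → just (st inp [] I′ out)
... | no  _ = rule3 s

step : State → Maybe State
step s@(st inp D [] out)      = rule2 s
step s@(st inp D (y ∷ I) out) =
  if y ≡ᵇ nextOut s then just (st inp D I (out Data.List.++ (y ∷ []))) else rule2 s
  where import Data.List

run : ℕ → State → Maybe State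
run zero    s = just s
run (suc k) s = step s >>= run k

initial : List ℕ → State
initial π = st π [] [] []

SortedByAlgorithm : List ℕ → Set
SortedByAlgorithm π =
  ∃ λ k → ∃ λ s → run k (initial π) ≡ just s × output s ≡ identityPerm (length π)

p3142 : List ℕ
p3142 = 3 ∷ 1 ∷ 4 ∷ 2 ∷ []

p3241 : List ℕ
p3241 = 3 ∷ 2 ∷ 4 ∷ 1 ∷ []

module Submission where

-- We follow the run of the algorithm on π, a permutation of 1..n, through
-- its states (input, D, I, output), and track two properties of a state:
--  * the invariant (`Invariant`): the output is 1, …, k, the output and the
--    entries still in the machine form a permutation of 1..n, D is
--    decreasing, I is increasing, and all of D lies below the top of I;
--  * an obstruction (`Obstructed`) on the word `pending` = reverse D ++ input
--    of entries not yet moved to I: it contains a 3142 or a 3241, or some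
--    entry y of I is straddled by a pair a … b of it with b < y < a.
-- Every move of the algorithm preserves the invariant, neither creates nor
-- destroys obstructions, and decreases the measure 3|input| + 2|D| + |I|
-- (`step-ok`).  An unobstructed state still holding entries can always move
-- (`progress`), and a finished state is unobstructed.  Hence the algorithm
-- sorts π iff the initial state is unobstructed (`sorted⇔unobstructed`);
-- there the pending word is π and I is empty, so this says exactly that π
-- avoids 3142 and 3241 (`unobstructed⇔avoids`).

open import Defs
open import Data.Nat
  using (ℕ; zero; suc; _+_; _*_; _∸_; _<_; _>_; _≤_; _<ᵇ_; _≤ᵇ_; _≡ᵇ_; _≟_; s≤s; z≤n; z<s)
open import Data.Nat.Properties
open import Data.Nat.Tactic.RingSolver using (solve-∀)
open import Data.Bool using (true; false; T; _∧_)
open import Data.Bool.Properties using (T-≡; ∧-identityʳ)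
open import Data.Unit using (⊤; tt)
open import Data.Empty using (⊥-elim)
open import Data.List using (List; []; _∷_; _++_; length; reverse; applyUpTo; _ʳ++_)
open import Data.List.Properties
  using (≡-dec; length-applyUpTo; applyUpTo-∷ʳ; length-++; ++-assoc; ʳ++-defn; unfold-reverse; length-ʳ++)
open import Data.List.Relation.Unary.All as All using (All; []; _∷_)
open import Data.List.Relation.Unary.Any using (here; there)
open import Data.List.Relation.Unary.Any.Properties using (reverse⁺; reverse⁻)
open import Data.List.Relation.Unary.AllPairs as AllPairs using (AllPairs; []; _∷_)
import Data.List.Relation.Unary.AllPairs.Properties as AllPairsₚ
open import Data.List.Relation.Unary.Unique.Propositional using (Unique)
open import Data.List.Membership.Propositional using (_∈_)
open import Data.List.Membership.Propositional.Properties
  using (∈-++⁺ˡ; ∈-++⁺ʳ; ∈-++⁻; ∈-applyUpTo⁺; ∈-applyUpTo⁻)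
open import Data.List.Relation.Binary.Permutation.Propositional
  using (_↭_; ↭-sym; ↭-trans; ↭⇒↭ₛ; module PermutationReasoning)
import Data.List.Relation.Binary.Permutation.Propositional.Properties as Permₚ
import Data.List.Relation.Binary.Permutation.Setoid.Properties as PermSetoidₚ
open import Data.List.Relation.Binary.Sublist.Propositional
  using (_⊆_; []; _∷_; _∷ʳ_; ⊆-refl; ⊆-trans; from∈)
  renaming (lookup to ⊆-lookup)
open import Data.List.Relation.Binary.Sublist.Propositional.Properties using (++⁺ˡ; ++⁺; ∷ˡ⁻; ∷⁻; ∷ʳ⁻)
open import Data.Maybe using (Maybe; just; nothing; _>>=_)
open import Data.Product using (∃; _×_; _,_; proj₁; proj₂)
open import Data.Sum using (_⊎_; inj₁; inj₂; [_,_])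
open import Relation.Binary.PropositionalEquality
  using (_≡_; _≢_; refl; sym; cong; subst; setoid; module ≡-Reasoning) renaming (trans to ≡-trans)
open import Relation.Binary.Definitions using (tri<; tri≈; tri>)
open import Relation.Nullary using (¬_; yes; no)
open import Data.Fin using (Fin; zero; suc; #_)
open import Function using (id; _∘_)
open import Function.Bundles using (_⇔_; mk⇔; Equivalence)
open import Function.Construct.Composition using (_⇔-∘_)

<ᵇ≡true⇒< : ∀ {x y} → (x <ᵇ y) ≡ true → x < y
<ᵇ≡true⇒< {x} {y} e = <ᵇ⇒< x y (Equivalence.from T-≡ e)

<⇒<ᵇ≡true : ∀ {x y} → x < y → (x <ᵇ y) ≡ true
<⇒<ᵇ≡true x<y = Equivalence.to T-≡ (<⇒<ᵇ x<y)

<ᵇ≡false⇒≥ : ∀ {x y} → (x <ᵇ y) ≡ false → y ≤ x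
<ᵇ≡false⇒≥ e = ≮⇒≥ (λ x<y → subst T e (<⇒<ᵇ x<y))

∧≡true : ∀ {a b} → (a ∧ b) ≡ true → a ≡ true × b ≡ true
∧≡true {true} {true} refl = refl , refl

-- Lists of distinct entries.  All entries ever handled by the machine are
-- distinct, since together with the output they form a permutation of 1..n.

unique-resp-↭ : ∀ {xs ys : List ℕ} → xs ↭ ys → Unique xs → Unique ys
unique-resp-↭ p = PermSetoidₚ.Unique-resp-↭ (setoid ℕ) (↭⇒↭ₛ p)

unique-++ʳ : ∀ xs {ys : List ℕ} → Unique (xs ++ ys) → Unique ys
unique-++ʳ []       u       = u
unique-++ʳ (_ ∷ xs) (_ ∷ u) = unique-++ʳ xs u

unique-disjoint : ∀ xs {ys : List ℕ} {u v} → Unique (xs ++ ys) → u ∈ xs → v ∈ ys → u ≢ v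
unique-disjoint (x ∷ xs) (x∉ ∷ _) (here refl) v∈ys = All.lookup x∉ (∈-++⁺ʳ xs v∈ys)
unique-disjoint (x ∷ xs) (_ ∷ u)  (there u∈xs) v∈ys = unique-disjoint xs u u∈xs v∈ys

identity-unique : ∀ n → Unique (identityPerm n)
identity-unique n = AllPairsₚ.applyUpTo⁺₁ suc n (λ i<j _ e → <⇒≢ i<j (suc-injective e))

-- Sorted lists and reversal.  Stacks are lists read from the top, so
-- reverse D lists the entries of D in the order they were pushed.

all-reverse : ∀ {P : ℕ → Set} {xs} → All P xs → All P (reverse xs)
all-reverse a = All.tabulate (λ m → All.lookup a (reverse⁻ m))

reverse-decreasing : ∀ {xs} → AllPairs _>_ xs → AllPairs _<_ (reverse xs)
reverse-decreasing [] = []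
reverse-decreasing {x ∷ xs} (x>xs ∷ dec) = subst (AllPairs _<_) (sym (unfold-reverse x xs))
  (AllPairsₚ.++⁺ (reverse-decreasing dec) ([] ∷ []) (All.map (_∷ []) (all-reverse x>xs)))

reverse-∷-++ : ∀ (t : ℕ) D r → reverse (t ∷ D) ++ r ≡ reverse D ++ t ∷ r
reverse-∷-++ t D r = ≡-trans (cong (_++ r) (unfold-reverse t D)) (++-assoc (reverse D) (t ∷ []) r)

-- Sublists.  Patterns are located as sublists (a ∷ b ∷ …) ⊆ w; these lemmas
-- move such occurrences between the words seen by successive states.

⊆-skip-prefix : ∀ {P : ℕ → Set} (xs : List ℕ) {ys z zs} →
                All P xs → ¬ P z → (z ∷ zs) ⊆ xs ++ ys → (z ∷ zs) ⊆ ys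
⊆-skip-prefix []       _          _   q          = q
⊆-skip-prefix (x ∷ xs) (_ ∷ Pxs)  ¬Pz (.x ∷ʳ q)  = ⊆-skip-prefix xs Pxs ¬Pz q
⊆-skip-prefix (x ∷ xs) (Px ∷ _)   ¬Pz (refl ∷ q) = ⊥-elim (¬Pz Px)

descent-in-suffix : ∀ (xs : List ℕ) {ys a b zs} → AllPairs _<_ xs →
                    (∀ {u v} → u ∈ xs → v ∈ ys → u < v) →
                    b < a → (a ∷ b ∷ zs) ⊆ xs ++ ys → (a ∷ b ∷ zs) ⊆ ys
descent-in-suffix []       _           _   _   q = q
descent-in-suffix (x ∷ xs) (_ ∷ inc)   xs<ys b<a (.x ∷ʳ q) =
  descent-in-suffix xs inc (λ u∈xs → xs<ys (there u∈xs)) b<a q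
descent-in-suffix (x ∷ xs) (x<xs ∷ _) xs<ys b<a (refl ∷ q) with ∈-++⁻ xs (⊆-lookup q (here refl))
... | inj₁ b∈xs = ⊥-elim (<-asym b<a (All.lookup x<xs b∈xs))
... | inj₂ b∈ys = ⊥-elim (<-asym b<a (xs<ys (here refl) b∈ys))

remaining : State → List ℕ
remaining s = I s ++ D s ++ input s

BelowTop : List ℕ → List ℕ → Set
BelowTop D []      = ⊤
BelowTop D (y ∷ _) = All (_< y) D

record Invariant (n : ℕ) (s : State) : Set where
  field
    output-sorted : output s ≡ identityPerm (length (output s))
    conserved     : output s ++ remaining s ↭ identityPerm n
    D-decreasing  : AllPairs _>_ (D s)
    I-increasing  : AllPairs _<_ (I s)
    D-below-I     : BelowTop (D s) (I s)
open Invariant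

initial-invariant : ∀ π → IsPerm π → Invariant (length π) (initial π)
initial-invariant π isPerm = record
  { output-sorted = refl ; conserved = isPerm ; D-decreasing = [] ; I-increasing = [] ; D-below-I = tt }

module _ {n s} (inv : Invariant n s) where

  all-unique : Unique (output s ++ remaining s)
  all-unique = unique-resp-↭ (↭-sym (conserved inv)) (identity-unique n)

  remaining-unique : Unique (remaining s)
  remaining-unique = unique-++ʳ (output s) all-unique

  remaining-large : ∀ {e} → e ∈ remaining s → length (output s) < e
  remaining-large {e} e∈rem with ∈-applyUpTo⁻ suc (Permₚ.∈-resp-↭ (conserved inv) (∈-++⁺ʳ (output s) e∈rem))
  ... | i , _ , refl with length (output s) ≤? i
  ...   | yes k≤i = s≤s k≤i
  ...   | no  k≰i = ⊥-elim (unique-disjoint (output s) all-unique e∈out e∈rem refl)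
    where
      e∈out : suc i ∈ output s
      e∈out = subst (suc i ∈_) (sym (output-sorted inv)) (∈-applyUpTo⁺ suc (≰⇒> k≰i))

  total-length : length (output s) + length (remaining s) ≡ n
  total-length = begin
    length (output s) + length (remaining s) ≡⟨ sym (length-++ (output s)) ⟩
    length (output s ++ remaining s)         ≡⟨ Permₚ.↭-length (conserved inv) ⟩
    length (identityPerm n)                  ≡⟨ length-applyUpTo suc n ⟩
    n                                        ∎
    where open ≡-Reasoning

  next-remaining : ∀ {e} → e ∈ remaining s → nextOut s ∈ remaining s
  next-remaining {e} e∈rem with ∈-++⁻ (output s) (Permₚ.∈-resp-↭ (↭-sym (conserved inv)) (∈-applyUpTo⁺ suc k<n))
    where
      nonempty : ∀ {xs : List ℕ} → e ∈ xs → 0 < length xs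
      nonempty (here _)  = z<s
      nonempty (there _) = z<s
      k<n : length (output s) < n
      k<n = <-≤-trans (m<m+n _ (nonempty e∈rem)) (≤-reflexive total-length)
  ... | inj₂ next∈rem = next∈rem
  ... | inj₁ next∈out with ∈-applyUpTo⁻ suc (subst (nextOut s ∈_) (output-sorted inv) next∈out)
  ...   | i , i<k , eq = ⊥-elim (<-irrefl (sym (suc-injective eq)) i<k)

  finished-output : remaining s ≡ [] → output s ≡ identityPerm n
  finished-output done = ≡-trans (output-sorted inv) (cong identityPerm output-length)
    where
      output-length : length (output s) ≡ n
      output-length = begin
        length (output s)                        ≡⟨ sym (+-identityʳ _) ⟩
        length (output s) + 0                    ≡⟨ cong (λ r → length (output s) + length r) (sym done) ⟩
        length (output s) + length (remaining s) ≡⟨ total-length ⟩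
        n                                        ∎
        where open ≡-Reasoning

  sorted-finished : output s ≡ identityPerm n → remaining s ≡ []
  sorted-finished sorted = empty (+-cancelˡ-≡ n _ _ lengths)
    where
      output-length : length (output s) ≡ n
      output-length = ≡-trans (cong length sorted) (length-applyUpTo suc n)
      lengths : n + length (remaining s) ≡ n + 0
      lengths = begin
        n + length (remaining s)                 ≡⟨ cong (_+ length (remaining s)) (sym output-length) ⟩
        length (output s) + length (remaining s) ≡⟨ total-length ⟩
        n                                        ≡⟨ sym (+-identityʳ n) ⟩
        n + 0                                    ∎
        where open ≡-Reasoning
      empty : ∀ {xs : List ℕ} → length xs ≡ 0 → xs ≡ []
      empty {[]}    _  = refl
      empty {_ ∷ _} ()

-- Obstructions.  The word `pending s` lists the entries not yet moved to I in
-- the order in which they entered (or will enter) D.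

pending : State → List ℕ
pending s = reverse (D s) ++ input s

pending⊆remaining : ∀ s {e} → e ∈ pending s → e ∈ remaining s
pending⊆remaining (st inp D I _) e∈w with ∈-++⁻ (reverse D) e∈w
... | inj₁ e∈D   = ∈-++⁺ʳ I (∈-++⁺ˡ {xs = D} {ys = inp} (reverse⁻ e∈D))
... | inj₂ e∈inp = ∈-++⁺ʳ I (∈-++⁺ʳ D e∈inp)

-- The two forbidden shapes of a subsequence a b c d: 3142 (b < d < a < c)
-- and 3241 (d < b < a < c).
Forbidden : ℕ → ℕ → ℕ → ℕ → Set
Forbidden a b c d = (b < d × d < a × a < c) ⊎ (d < b × b < a × a < c)

forbidden-b<a : ∀ {a b c d} → Forbidden a b c d → b < a
forbidden-b<a (inj₁ (b<d , d<a , _)) = <-trans b<d d<a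
forbidden-b<a (inj₂ (_ , b<a , _))   = b<a

forbidden-d<a : ∀ {a b c d} → Forbidden a b c d → d < a
forbidden-d<a (inj₁ (_ , d<a , _))   = d<a
forbidden-d<a (inj₂ (d<b , b<a , _)) = <-trans d<b b<a

forbidden-a<c : ∀ {a b c d} → Forbidden a b c d → a < c
forbidden-a<c (inj₁ (_ , _ , a<c)) = a<c
forbidden-a<c (inj₂ (_ , _ , a<c)) = a<c

data ForbiddenIn (w : List ℕ) : Set where
  occurs : ∀ a b c d → (a ∷ b ∷ c ∷ d ∷ []) ⊆ w → Forbidden a b c d → ForbiddenIn w

-- An entry y of I straddled by a pair a … b of w with b < y < a: y cannot
-- leave I before b is output, while a, preceding b and exceeding y, can
-- neither wait in D beneath b nor be placed on I above y.
data Straddled (w I : List ℕ) : Set where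
  straddle : ∀ y a b → y ∈ I → (a ∷ b ∷ []) ⊆ w → b < y → y < a → Straddled w I

Obstruction : List ℕ → List ℕ → Set
Obstruction w I = ForbiddenIn w ⊎ Straddled w I

Obstructed : State → Set
Obstructed s = Obstruction (pending s) (I s)

finished-unobstructed : ∀ s → remaining s ≡ [] → ¬ Obstructed s
finished-unobstructed (st [] [] [] _) refl (inj₁ (occurs _ _ _ _ () _))
finished-unobstructed (st [] [] [] _) refl (inj₂ (straddle _ _ _ () _ _ _))

data NoPush : List ℕ → List ℕ → List ℕ → Set where
  input-empty  : ∀ {D I} → NoPush [] D I
  push-illegal : ∀ {x r D I} → (canPushI x I ∧ canPushD x D) ≡ false → NoPush (x ∷ r) D I

data Step : State → State → Set where
  output-top : ∀ {inp D y I out} → y ≡ suc (length out) →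
               Step (st inp D (y ∷ I) out) (st inp D I (out ++ y ∷ []))
  flush      : ∀ {inp d D I I′ out} → d ∷ D ≡ nextBlock (suc (length out)) (suc (length D)) →
               moveAll (d ∷ D) I ≡ just I′ → Step (st inp (d ∷ D) I out) (st inp [] I′ out)
  push       : ∀ {x inp D I out} → (canPushI x I ∧ canPushD x D) ≡ true →
               Step (st (x ∷ inp) D I out) (st inp (x ∷ D) I out)
  transfer   : ∀ {inp t D I out} → NoPush inp (t ∷ D) I →
               Step (st inp (t ∷ D) I out) (st inp D (t ∷ I) out)

rule4-sound : ∀ s {s′} → NoPush (input s) (D s) (I s) → rule4 s ≡ just s′ → Step s s′
rule4-sound (st inp []      I out) _ ()
rule4-sound (st inp (t ∷ D) I out) noPush eq with canPushI t I
rule4-sound (st inp (t ∷ D) I out) noPush refl | true = transfer noPush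

rule3-sound : ∀ s {s′} → rule3 s ≡ just s′ → Step s s′
rule3-sound (st [] D I out) eq = rule4-sound _ input-empty eq
rule3-sound (st (x ∷ inp) D I out) eq with canPushI x I ∧ canPushD x D in legal
rule3-sound (st (x ∷ inp) D I out) refl | true  = push legal
rule3-sound (st (x ∷ inp) D I out) eq   | false = rule4-sound _ (push-illegal legal) eq

rule2-sound : ∀ s {s′} → rule2 s ≡ just s′ → Step s s′
rule2-sound (st inp [] I out) eq = rule3-sound _ eq
rule2-sound (st inp (d ∷ D) I out) eq with ≡-dec _≟_ (d ∷ D) (nextBlock (suc (length out)) (suc (length D)))
... | no  _     = rule3-sound _ eq
... | yes block with moveAll (d ∷ D) I in moved
...   | just I′ with eq
...     | refl = flush block moved
rule2-sound (st inp (d ∷ D) I out) () | yes _ | nothing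

step-sound : ∀ s {s′} → step s ≡ just s′ → Step s s′
step-sound (st inp D [] out) eq = rule2-sound _ eq
step-sound (st inp D (y ∷ I) out) eq with y ≡ᵇ suc (length out) in isNext
step-sound (st inp D (y ∷ I) out) refl | true  = output-top (≡ᵇ⇒≡ y _ (Equivalence.from T-≡ isNext))
step-sound (st inp D (y ∷ I) out) eq   | false = rule2-sound _ eq

measure : State → ℕ
measure s = 3 * length (input s) + 2 * length (D s) + length (I s)

record WellBehaved (n : ℕ) (s s′ : State) : Set where
  field
    invariant′           : Invariant n s′
    obstruction-forward  : Obstructed s → Obstructed s′
    obstruction-backward : Obstructed s′ → Obstructed s
    measure-decreases    : measure s′ < measure s

after-output : ∀ i d j → 3 * i + 2 * d + suc j ≡ suc (3 * i + 2 * d + j)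
after-output = solve-∀

after-push : ∀ i d j → 3 * suc i + 2 * d + j ≡ suc (3 * i + 2 * suc d + j)
after-push = solve-∀

after-transfer : ∀ i d j → 3 * i + 2 * suc d + j ≡ suc (3 * i + 2 * d + suc j)
after-transfer = solve-∀

after-flush : ∀ i d j → 3 * i + 2 * 0 + (suc d + j) < 3 * i + 2 * suc d + j
after-flush i d j = subst (3 * i + 2 * 0 + (suc d + j) <_) (sym (flushed i d j)) (m<n+m _ {suc d} z<s)
  where
    flushed : ∀ i d j → 3 * i + 2 * suc d + j ≡ suc d + (3 * i + 2 * 0 + (suc d + j))
    flushed = solve-∀

below-pop : ∀ {D y I} → BelowTop D (y ∷ I) → AllPairs _<_ (y ∷ I) → BelowTop D I
below-pop {I = []}     _     _                 = tt
below-pop {I = y′ ∷ _} D<y ((y<y′ ∷ _) ∷ _) = All.map (λ d<y → <-trans d<y y<y′) D<y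

output-top-ok : ∀ {n inp D y I out} → Invariant n (st inp D (y ∷ I) out) → y ≡ suc (length out) →
                WellBehaved n (st inp D (y ∷ I) out) (st inp D I (out ++ y ∷ []))
output-top-ok {n} {inp} {D} {y} {I} {out} inv refl = record
  { invariant′ = record
      { output-sorted = ≡-trans extended (cong identityPerm (sym extended-length))
      ; conserved     = subst (_↭ identityPerm n) (sym (++-assoc out (y ∷ []) (remaining s′))) (conserved inv)
      ; D-decreasing  = D-decreasing inv
      ; I-increasing  = AllPairs.tail (I-increasing inv)
      ; D-below-I     = below-pop (D-below-I inv) (I-increasing inv) }
  ; obstruction-forward  = forward
  ; obstruction-backward = backward
  ; measure-decreases    = ≤-reflexive (sym (after-output (length inp) (length D) (length I))) }
  where
    s′ = st inp D I (out ++ y ∷ [])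
    extended : out ++ y ∷ [] ≡ identityPerm (suc (length out))
    extended = ≡-trans (cong (_++ y ∷ []) (output-sorted inv)) (applyUpTo-∷ʳ suc (length out))
    extended-length : length (out ++ y ∷ []) ≡ suc (length out)
    extended-length = ≡-trans (cong length extended) (length-applyUpTo suc (suc (length out)))
    -- y cannot be straddled: the lower entry b of the pair would have been output already.
    forward : Obstructed (st inp D (y ∷ I) out) → Obstructed s′
    forward (inj₁ forbidden) = inj₁ forbidden
    forward (inj₂ (straddle y′ a b (there y′∈I) ab b<y′ y′<a)) = inj₂ (straddle y′ a b y′∈I ab b<y′ y′<a)
    forward (inj₂ (straddle .y a b (here refl) ab b<y y<a)) =
      ⊥-elim (<⇒≱ b<y (remaining-large inv
        (pending⊆remaining (st inp D (y ∷ I) out) (⊆-lookup ab (there (here refl))))))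
    backward : Obstructed s′ → Obstructed (st inp D (y ∷ I) out)
    backward (inj₁ forbidden) = inj₁ forbidden
    backward (inj₂ (straddle y′ a b y′∈I ab b<y′ y′<a)) = inj₂ (straddle y′ a b (there y′∈I) ab b<y′ y′<a)

-- Rule 3: push the next input entry onto D.  The pending word is unchanged.

push-onto-D : ∀ {x D} → AllPairs _>_ D → canPushD x D ≡ true → All (_< x) D
push-onto-D {D = []}    _          _     = []
push-onto-D {D = t ∷ _} (t>D ∷ _) legal =
  t<x ∷ All.map (λ d<t → <-trans d<t t<x) t>D
  where t<x = <ᵇ≡true⇒< legal

push-below-I : ∀ {x D I} → BelowTop D I → canPushI x I ≡ true → BelowTop (x ∷ D) I
push-below-I {I = []}    _   _     = tt
push-below-I {I = _ ∷ _} D<y legal = <ᵇ≡true⇒< legal ∷ D<y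

push-ok : ∀ {n x inp D I out} → Invariant n (st (x ∷ inp) D I out) →
          (canPushI x I ∧ canPushD x D) ≡ true →
          WellBehaved n (st (x ∷ inp) D I out) (st inp (x ∷ D) I out)
push-ok {n} {x} {inp} {D} {I} {out} inv legal = record
  { invariant′ = record
      { output-sorted = output-sorted inv
      ; conserved     = ↭-trans (Permₚ.++⁺ˡ out (Permₚ.++⁺ˡ I (↭-sym (Permₚ.shift x D inp)))) (conserved inv)
      ; D-decreasing  = push-onto-D (D-decreasing inv) legalD ∷ D-decreasing inv
      ; I-increasing  = I-increasing inv
      ; D-below-I     = push-below-I (D-below-I inv) legalI }
  ; obstruction-forward  = subst (λ w → Obstruction w I) (sym same-pending)
  ; obstruction-backward = subst (λ w → Obstruction w I) same-pending
  ; measure-decreases    = ≤-reflexive (sym (after-push (length inp) (length D) (length I))) }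
  where
    legalI = proj₁ (∧≡true legal)
    legalD = proj₂ (∧≡true legal)
    same-pending : reverse (x ∷ D) ++ inp ≡ reverse D ++ x ∷ inp
    same-pending = reverse-∷-++ x D inp

below-all : ∀ {D I d e} → BelowTop D I → AllPairs _<_ I → d ∈ D → e ∈ I → d < e
below-all {I = y ∷ _} D<y _           d∈D (here refl) = All.lookup D<y d∈D
below-all {I = y ∷ _} D<y (y<I ∷ _) d∈D (there e∈I) = <-trans (All.lookup D<y d∈D) (All.lookup y<I e∈I)

below-empty : ∀ I → BelowTop [] I
below-empty []      = tt
below-empty (_ ∷ _) = []

transfer-legal : ∀ {t D I} → BelowTop (t ∷ D) I → canPushI t I ≡ true
transfer-legal {I = []}    _         = refl
transfer-legal {I = _ ∷ _} (t<y ∷ _) = <⇒<ᵇ≡true t<y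

moveAll-legal : ∀ D I → AllPairs _>_ D → BelowTop D I → moveAll D I ≡ just (D ʳ++ I)
moveAll-legal []      I _               _   = refl
moveAll-legal (x ∷ D) I (x>D ∷ dec) D<I rewrite transfer-legal {x} {D} {I} D<I =
  moveAll-legal D (x ∷ I) dec x>D

moveAll-increasing : ∀ D I → AllPairs _>_ D → BelowTop D I → AllPairs _<_ I → AllPairs _<_ (D ʳ++ I)
moveAll-increasing []      I _             _   inc = inc
moveAll-increasing (x ∷ D) I (x>D ∷ dec) D<I inc =
  moveAll-increasing D (x ∷ I) dec x>D (All.tabulate (below-all D<I inc (here refl)) ∷ inc)

moveAll-perm : ∀ (D I inp : List ℕ) → (D ʳ++ I) ++ inp ↭ I ++ D ++ inp
moveAll-perm D I inp = begin
  (D ʳ++ I) ++ inp        ≡⟨ cong (_++ inp) (ʳ++-defn D) ⟩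
  (reverse D ++ I) ++ inp ↭⟨ Permₚ.++⁺ʳ inp (Permₚ.++⁺ʳ I (Permₚ.↭-reverse D)) ⟩
  (D ++ I) ++ inp         ↭⟨ Permₚ.++⁺ʳ inp (Permₚ.++-comm D I) ⟩
  (I ++ D) ++ inp         ≡⟨ ++-assoc I D inp ⟩
  I ++ D ++ inp           ∎
  where open PermutationReasoning

block-below : ∀ {k m u e} → u ∈ nextBlock (suc k) m → k < e → ¬ e ∈ nextBlock (suc k) m → u < e
block-below {k} {m} {u} {e} u∈block k<e e∉block
  with ∈-applyUpTo⁻ (suc k +_) (reverse⁻ {xs = applyUpTo (suc k +_) m} u∈block)
... | i , i<m , refl with suc k + i <? e
...   | yes u<e = u<e
...   | no  u≮e = ⊥-elim (e∉block (reverse⁺ e∈block))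
  where
    j<m : e ∸ suc k < m
    j<m = +-cancelˡ-< (suc k) _ _ (begin-strict
      suc k + (e ∸ suc k) ≡⟨ m+[n∸m]≡n k<e ⟩
      e                   ≤⟨ ≮⇒≥ u≮e ⟩
      suc k + i           <⟨ +-monoʳ-< (suc k) i<m ⟩
      suc k + m           ∎)
      where open ≤-Reasoning
    e∈block : e ∈ applyUpTo (suc k +_) m
    e∈block = subst (_∈ applyUpTo (suc k +_) m) (m+[n∸m]≡n k<e) (∈-applyUpTo⁺ (suc k +_) j<m)

block-below-input : ∀ {n inp D I out u e} → Invariant n (st inp D I out) →
                    D ≡ nextBlock (suc (length out)) (length D) → u ∈ D → e ∈ inp → u < e
block-below-input {inp = inp} {D} {I} {out} inv block u∈D e∈inp =
  block-below {k = length out} {m = length D} (subst (_ ∈_) block u∈D)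
    (remaining-large inv (∈-++⁺ʳ I (∈-++⁺ʳ D e∈inp)))
    (λ e∈block → unique-disjoint D (unique-++ʳ I (remaining-unique inv))
                   (subst (_ ∈_) (sym block) e∈block) e∈inp refl)

flush-ok : ∀ {n inp d D I I′ out} → Invariant n (st inp (d ∷ D) I out) →
           d ∷ D ≡ nextBlock (suc (length out)) (suc (length D)) → moveAll (d ∷ D) I ≡ just I′ →
           WellBehaved n (st inp (d ∷ D) I out) (st inp [] I′ out)
flush-ok {n} {inp} {d} {D} {I} {I′} {out} inv block moved
  with ≡-trans (sym moved) (moveAll-legal (d ∷ D) I (D-decreasing inv) (D-below-I inv))
... | refl = record
  { invariant′ = record
      { output-sorted = output-sorted inv
      ; conserved     = ↭-trans (Permₚ.++⁺ˡ out (moveAll-perm (d ∷ D) I inp)) (conserved inv)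
      ; D-decreasing  = []
      ; I-increasing  = moveAll-increasing (d ∷ D) I (D-decreasing inv) (D-below-I inv) (I-increasing inv)
      ; D-below-I     = below-empty _ }
  ; obstruction-forward  = forward
  ; obstruction-backward = backward
  ; measure-decreases    = subst (λ m → 3 * length inp + 2 * 0 + m < measure (st inp (d ∷ D) I out))
                             (sym (length-ʳ++ (d ∷ D))) (after-flush (length inp) (length D) (length I)) }
  where
    D<inp : ∀ {u e} → u ∈ d ∷ D → e ∈ inp → u < e
    D<inp = block-below-input inv block
    -- Obstructions start with a descent, which cannot begin inside reverse D.
    in-input : ∀ {a b zs} → b < a → (a ∷ b ∷ zs) ⊆ reverse (d ∷ D) ++ inp → (a ∷ b ∷ zs) ⊆ inp
    in-input = descent-in-suffix (reverse (d ∷ D)) (reverse-decreasing (D-decreasing inv))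
                 (λ u∈D e∈inp → D<inp (reverse⁻ u∈D) e∈inp)
    forward : Obstructed (st inp (d ∷ D) I out) → Obstructed (st inp [] ((d ∷ D) ʳ++ I) out)
    forward (inj₁ (occurs a b c e abce f)) = inj₁ (occurs a b c e (in-input (forbidden-b<a f) abce) f)
    forward (inj₂ (straddle y a b y∈I ab b<y y<a)) =
      inj₂ (straddle y a b (subst (y ∈_) (sym (ʳ++-defn (d ∷ D))) (∈-++⁺ʳ (reverse (d ∷ D)) y∈I))
                     (in-input (<-trans b<y y<a) ab) b<y y<a)
    backward : Obstructed (st inp [] ((d ∷ D) ʳ++ I) out) → Obstructed (st inp (d ∷ D) I out)
    backward (inj₁ (occurs a b c e abce f)) = inj₁ (occurs a b c e (++⁺ˡ (reverse (d ∷ D)) abce) f)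
    backward (inj₂ (straddle y a b y∈I′ ab b<y y<a))
      with ∈-++⁻ (reverse (d ∷ D)) (subst (y ∈_) (ʳ++-defn (d ∷ D)) y∈I′)
    ... | inj₁ y∈D = ⊥-elim (<-asym b<y (D<inp (reverse⁻ y∈D) (⊆-lookup ab (there (here refl)))))
    ... | inj₂ y∈I = inj₂ (straddle y a b y∈I (++⁺ˡ (reverse (d ∷ D)) ab) b<y y<a)

-- Rule 4: move the top t of D onto I.  The pending word loses t, and t
-- becomes the new top of I.

forbidden-around : ∀ (xs : List ℕ) {ys t a b c d} → AllPairs _<_ xs → All (_< t) xs → Forbidden a b c d →
                   (a ∷ b ∷ c ∷ d ∷ []) ⊆ xs ++ t ∷ ys → ForbiddenIn (xs ++ ys) ⊎ Straddled ys (t ∷ [])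
forbidden-around []       _ _ f (_ ∷ʳ abcd) = inj₁ (occurs _ _ _ _ abcd f)
forbidden-around []       _ _ f (refl ∷ bcd) =
  inj₂ (straddle _ _ _ (here refl) (∷ˡ⁻ bcd) (forbidden-d<a f) (forbidden-a<c f))
forbidden-around (x ∷ xs) (_ ∷ inc) (_ ∷ xs<t) f (.x ∷ʳ abcd) with forbidden-around xs inc xs<t f abcd
... | inj₁ (occurs a b c d abcd′ f′) = inj₁ (occurs a b c d (x ∷ʳ abcd′) f′)
... | inj₂ straddled               = inj₂ straddled
forbidden-around (x ∷ xs) (x<xs ∷ _) (x<t ∷ _) f (refl ∷ bcd)
  with ⊆-skip-prefix xs x<xs (λ x<b → <-asym x<b (forbidden-b<a f)) bcd
... | _    ∷ʳ bcd′ = inj₁ (occurs _ _ _ _ (refl ∷ ++⁺ˡ xs bcd′) f)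
... | refl ∷ _     = ⊥-elim (<-asym x<t (forbidden-b<a f))

-- Rule 4 fires only when the next input entry x cannot be pushed.  If t is
-- then straddled by a pair a … b of the input, the state was already
-- obstructed: either x is too large for I (x straddles the top of I with b),
-- or x is too small for D, and t x a b is a 3142 or 3241.
straddled-transfer : ∀ {n inp t D I out a b} → Invariant n (st inp (t ∷ D) I out) →
                     NoPush inp (t ∷ D) I → (a ∷ b ∷ []) ⊆ inp → b < t → t < a →
                     Obstructed (st inp (t ∷ D) I out)
straddled-transfer {inp = x ∷ r} {t} {D} {I} inv (push-illegal illegal) ab b<t t<a
  with canPushI x I in legalI
straddled-transfer {inp = x ∷ r} {t} {D} {y ∷ I} {b = b} inv (push-illegal illegal) ab b<t t<a | false =
  inj₂ (straddle y x b (here refl) (++⁺ˡ (reverse (t ∷ D)) (refl ∷ from∈ b∈r)) (<-trans b<t t<y) y<x)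
  where
    b∈r = ⊆-lookup (∷⁻ ab) (here refl)
    t<y = All.lookup (D-below-I inv) (here refl)
    y<x = ≤∧≢⇒< (<ᵇ≡false⇒≥ legalI)
            (unique-disjoint (y ∷ I) (remaining-unique inv) (here refl) (∈-++⁺ʳ (t ∷ D) (here refl)))
straddled-transfer {inp = x ∷ r} {t} {D} {I} {a = a} {b} inv (push-illegal illegal) ab b<t t<a | true =
  inj₁ (occurs t x a b (subst ((t ∷ x ∷ a ∷ b ∷ []) ⊆_) (sym (reverse-∷-++ t D (x ∷ r)))
                          (++⁺ˡ (reverse D) (refl ∷ refl ∷ ab′))) shape)
  where
    D∷inp-unique = unique-++ʳ I (remaining-unique inv)
    x<t : x < t
    x<t = ≤∧≢⇒< (<ᵇ≡false⇒≥ illegal)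
            (λ x≡t → unique-disjoint (t ∷ D) D∷inp-unique (here refl) (here refl) (sym x≡t))
    ab′ : (a ∷ b ∷ []) ⊆ r
    ab′ = ∷ʳ⁻ (λ a≡x → <-asym x<t (subst (t <_) a≡x t<a)) ab
    x≢b : x ≢ b
    x≢b = unique-disjoint (x ∷ []) (unique-++ʳ (t ∷ D) D∷inp-unique) (here refl) (⊆-lookup ab′ (there (here refl)))
    shape : Forbidden t x a b
    shape with <-cmp x b
    ... | tri< x<b _ _ = inj₁ (x<b , b<t , t<a)
    ... | tri≈ _ x≡b _ = ⊥-elim (x≢b x≡b)
    ... | tri> _ _ b<x = inj₂ (b<x , x<t , t<a)

transfer-ok : ∀ {n inp t D I out} → Invariant n (st inp (t ∷ D) I out) → NoPush inp (t ∷ D) I →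
              WellBehaved n (st inp (t ∷ D) I out) (st inp D (t ∷ I) out)
transfer-ok {n} {inp} {t} {D} {I} {out} inv noPush = record
  { invariant′ = record
      { output-sorted = output-sorted inv
      ; conserved     = ↭-trans (Permₚ.++⁺ˡ out (↭-sym (Permₚ.shift t I (D ++ inp)))) (conserved inv)
      ; D-decreasing  = AllPairs.tail (D-decreasing inv)
      ; I-increasing  = All.tabulate (below-all (D-below-I inv) (I-increasing inv) (here refl)) ∷ I-increasing inv
      ; D-below-I     = D<t }
  ; obstruction-forward  = forward
  ; obstruction-backward = backward
  ; measure-decreases    = ≤-reflexive (sym (after-transfer (length inp) (length D) (length I))) }
  where
    D<t : All (_< t) D
    D<t = AllPairs.head (D-decreasing inv)
    old-pending : reverse (t ∷ D) ++ inp ≡ reverse D ++ t ∷ inp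
    old-pending = reverse-∷-++ t D inp
    pending-shrinks : reverse D ++ inp ⊆ reverse (t ∷ D) ++ inp
    pending-shrinks = subst (reverse D ++ inp ⊆_) (sym old-pending) (++⁺ ⊆-refl (t ∷ʳ ⊆-refl))
    -- A forbidden occurrence through t turns into a straddle of the new top t.
    forward : Obstructed (st inp (t ∷ D) I out) → Obstructed (st inp D (t ∷ I) out)
    forward (inj₁ (occurs a b c d abcd f))
      with forbidden-around (reverse D) (reverse-decreasing (AllPairs.tail (D-decreasing inv))) (all-reverse D<t) f
             (subst ((a ∷ b ∷ c ∷ d ∷ []) ⊆_) old-pending abcd)
    ... | inj₁ forbidden = inj₁ forbidden
    ... | inj₂ (straddle .t c′ d′ (here refl) cd d′<t t<c′) =
      inj₂ (straddle t c′ d′ (here refl) (++⁺ˡ (reverse D) cd) d′<t t<c′)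
    -- a exceeds y, hence everything in D, so the pair lies in the input.
    forward (inj₂ (straddle y a b y∈I ab b<y y<a)) =
      inj₂ (straddle y a b (there y∈I) (++⁺ˡ (reverse D) ab′) b<y y<a)
      where
        D<y = all-reverse (All.tabulate (λ d∈D → below-all (D-below-I inv) (I-increasing inv) d∈D y∈I))
        ab′ = ⊆-skip-prefix (reverse (t ∷ D)) D<y (λ a<y → <-asym a<y y<a) ab
    backward : Obstructed (st inp D (t ∷ I) out) → Obstructed (st inp (t ∷ D) I out)
    backward (inj₁ (occurs a b c d abcd f)) = inj₁ (occurs a b c d (⊆-trans abcd pending-shrinks) f)
    backward (inj₂ (straddle y a b (there y∈I) ab b<y y<a)) =
      inj₂ (straddle y a b y∈I (⊆-trans ab pending-shrinks) b<y y<a)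
    backward (inj₂ (straddle .t a b (here refl) ab b<t t<a)) =
      straddled-transfer inv noPush (⊆-skip-prefix (reverse D) (all-reverse D<t) (λ a<t → <-asym a<t t<a) ab) b<t t<a

step-ok : ∀ {n s s′} → Invariant n s → Step s s′ → WellBehaved n s s′
step-ok inv (output-top isNext)  = output-top-ok inv isNext
step-ok inv (flush block moved)  = flush-ok inv block moved
step-ok inv (push legal)         = push-ok inv legal
step-ok inv (transfer noPush)    = transfer-ok inv noPush

TopIsNot : ℕ → List ℕ → Set
TopIsNot k []      = ⊤
TopIsNot k (y ∷ _) = y ≢ k

-- With D empty and neither rule 1 nor rule 3 applicable, the next entry to
-- output lies in the input behind an entry x too large for the top y of I,
-- and y is straddled by x and that next entry.
stuck-obstructed : ∀ {n inp I out e} → Invariant n (st inp [] I out) → e ∈ remaining (st inp [] I out) →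
                   TopIsNot (suc (length out)) I → NoPush inp [] I → Obstructed (st inp [] I out)
stuck-obstructed {I = I} inv e∈rem notTop noPush
  with ∈-++⁻ I (next-remaining inv e∈rem)
stuck-obstructed {I = y ∷ I} inv e∈rem notTop noPush | inj₁ (here next≡y) = ⊥-elim (notTop (sym next≡y))
stuck-obstructed {I = y ∷ I} inv e∈rem notTop noPush | inj₁ (there next∈I) =
  ⊥-elim (<⇒≱ (All.lookup (AllPairs.head (I-increasing inv)) next∈I) (remaining-large inv (here refl)))
stuck-obstructed {I = []}    inv e∈rem notTop (push-illegal ()) | inj₂ next∈inp
stuck-obstructed {inp = x ∷ r} {y ∷ I} {out} inv e∈rem notTop (push-illegal illegal) | inj₂ next∈inp =
  inj₂ (straddle y x next (here refl) (refl ∷ ∷ʳ⁻ next≢x (from∈ next∈inp)) next<y y<x)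
  where
    next = suc (length out)
    y<x : y < x
    y<x = ≤∧≢⇒< (<ᵇ≡false⇒≥ (≡-trans (sym (∧-identityʳ (x <ᵇ y))) illegal))
            (unique-disjoint (y ∷ I) (remaining-unique inv) (here refl) (here refl))
    next<y : next < y
    next<y = ≤∧≢⇒< (remaining-large inv (here refl)) (λ next≡y → notTop (sym next≡y))
    next≢x : next ≢ x
    next≢x next≡x = <-irrefl next≡x (<-trans next<y y<x)

Moves : (State → Maybe State) → State → Set
Moves rule s = ∃ λ s′ → rule s ≡ just s′

-- These lemmas follow the cascade of rules in `step`; the only way to get
-- stuck is the situation of `stuck-obstructed`.
module _ {n : ℕ} where

  rule4-progress : ∀ s {e} → Invariant n s → ¬ Obstructed s → e ∈ remaining s →
                   TopIsNot (nextOut s) (I s) → NoPush (input s) (D s) (I s) → Moves rule4 s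
  rule4-progress (st inp [] I out) inv unobstructed e∈rem notTop noPush =
    ⊥-elim (unobstructed (stuck-obstructed inv e∈rem notTop noPush))
  rule4-progress (st inp (t ∷ D) I out) inv _ _ _ _ rewrite transfer-legal {t} {D} {I} (D-below-I inv) = _ , refl

  rule3-progress : ∀ s {e} → Invariant n s → ¬ Obstructed s → e ∈ remaining s →
                   TopIsNot (nextOut s) (I s) → Moves rule3 s
  rule3-progress (st [] D I out) inv unobstructed e∈rem notTop =
    rule4-progress _ inv unobstructed e∈rem notTop input-empty
  rule3-progress (st (x ∷ inp) D I out) inv unobstructed e∈rem notTop with canPushI x I ∧ canPushD x D in legal
  ... | true  = _ , refl
  ... | false = rule4-progress _ inv unobstructed e∈rem notTop (push-illegal legal)

  rule2-progress : ∀ s {e} → Invariant n s → ¬ Obstructed s → e ∈ remaining s →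
                   TopIsNot (nextOut s) (I s) → Moves rule2 s
  rule2-progress (st inp [] I out) inv unobstructed e∈rem notTop = rule3-progress _ inv unobstructed e∈rem notTop
  rule2-progress (st inp (d ∷ D) I out) inv unobstructed e∈rem notTop
    with ≡-dec _≟_ (d ∷ D) (nextBlock (suc (length out)) (suc (length D)))
  ... | no  _ = rule3-progress _ inv unobstructed e∈rem notTop
  ... | yes _ rewrite moveAll-legal (d ∷ D) I (D-decreasing inv) (D-below-I inv) = _ , refl

  progress : ∀ s {e} → Invariant n s → ¬ Obstructed s → e ∈ remaining s → Moves step s
  progress (st inp D [] out) inv unobstructed e∈rem = rule2-progress _ inv unobstructed e∈rem tt
  progress (st inp D (y ∷ I) out) inv unobstructed e∈rem with y ≡ᵇ suc (length out) in isNext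
  ... | true  = _ , refl
  ... | false = rule2-progress _ inv unobstructed e∈rem (λ y≡next → subst T isNext (≡⇒≡ᵇ y _ y≡next))

open WellBehaved

-- From an unobstructed state the run ends with 1..n output; the fuel f
-- bounds the measure, which every move decreases.
run-to-end : ∀ {n} f s → measure s < f → Invariant n s → ¬ Obstructed s →
             ∃ λ k → ∃ λ s′ → run k s ≡ just s′ × output s′ ≡ identityPerm n
run-to-end (suc f) s (s≤s bound) inv unobstructed with remaining s in finished
... | [] = 0 , s , refl , finished-output inv finished
... | e ∷ _ with progress s inv unobstructed (subst (e ∈_) (sym finished) (here refl))
...   | s₁ , moved with step-ok inv (step-sound s moved)
...     | ok with run-to-end f s₁ (<-≤-trans (measure-decreases ok) bound) (invariant′ ok)
                   (unobstructed ∘ obstruction-backward ok)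
...       | k , s′ , ran , sorted = suc k , s′ , subst (λ m → (m >>= run k) ≡ just s′) (sym moved) ran , sorted

run-preserves : ∀ {n} k s {s′} → Invariant n s → run k s ≡ just s′ →
                Invariant n s′ × (Obstructed s → Obstructed s′)
run-preserves zero    s inv refl = inv , id
run-preserves (suc k) s inv ran with step s in moved
... | just s₁ with step-ok inv (step-sound s moved)
...   | ok with run-preserves k s₁ (invariant′ ok) ran
...     | inv′ , forward = inv′ , forward ∘ obstruction-forward ok
run-preserves (suc k) s inv () | nothing

sorted⇔unobstructed : ∀ π → IsPerm π → SortedByAlgorithm π ⇔ (¬ Obstructed (initial π))
sorted⇔unobstructed π isPerm = mk⇔ sorted⇒unobstructed unobstructed⇒sorted
  where
    inv₀ = initial-invariant π isPerm
    sorted⇒unobstructed : SortedByAlgorithm π → ¬ Obstructed (initial π)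
    sorted⇒unobstructed (k , s , ran , sorted) obstructed with run-preserves k (initial π) inv₀ ran
    ... | inv , forward = finished-unobstructed s (sorted-finished inv sorted) (forward obstructed)
    unobstructed⇒sorted : ¬ Obstructed (initial π) → SortedByAlgorithm π
    unobstructed⇒sorted = run-to-end (suc (measure (initial π))) (initial π) ≤-refl inv₀

-- Entries of an order-isomorphism table: a comparison holding in both lists,
-- or failing in both (the side of the pattern is decided by computation).
both-hold : ∀ {p q m n} → p < q → {T (m <ᵇ n)} → (p < q) ⇔ (m < n)
both-hold {m = m} {n} p<q {m<ᵇn} = mk⇔ (λ _ → <ᵇ⇒< m n m<ᵇn) (λ _ → p<q)

both-fail : ∀ {p q m n} → q ≤ p → {T (n ≤ᵇ m)} → (p < q) ⇔ (m < n)
both-fail {m = m} {n} q≤p {n≤ᵇm} =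
  mk⇔ (λ p<q → ⊥-elim (<⇒≱ p<q q≤p)) (λ m<n → ⊥-elim (<⇒≱ m<n (≤ᵇ⇒≤ n m n≤ᵇm)))

iso3142 : ∀ {a b c d} → b < d → d < a → a < c → OrderIso (a ∷ b ∷ c ∷ d ∷ []) p3142
iso3142 {a} {b} {c} {d} b<d d<a a<c = refl , table
  where
    b<a = <-trans b<d d<a
    b<c = <-trans b<a a<c
    d<c = <-trans d<a a<c
    table : (i j : Fin 4) → _
    table zero                   zero                   = both-fail ≤-refl
    table zero                   (suc zero)             = both-fail (<⇒≤ b<a)
    table zero                   (suc (suc zero))       = both-hold a<c
    table zero                   (suc (suc (suc zero))) = both-fail (<⇒≤ d<a)
    table (suc zero)             zero                   = both-hold b<a
    table (suc zero)             (suc zero)             = both-fail ≤-refl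
    table (suc zero)             (suc (suc zero))       = both-hold b<c
    table (suc zero)             (suc (suc (suc zero))) = both-hold b<d
    table (suc (suc zero))       zero                   = both-fail (<⇒≤ a<c)
    table (suc (suc zero))       (suc zero)             = both-fail (<⇒≤ b<c)
    table (suc (suc zero))       (suc (suc zero))       = both-fail ≤-refl
    table (suc (suc zero))       (suc (suc (suc zero))) = both-fail (<⇒≤ d<c)
    table (suc (suc (suc zero))) zero                   = both-hold d<a
    table (suc (suc (suc zero))) (suc zero)             = both-fail (<⇒≤ b<d)
    table (suc (suc (suc zero))) (suc (suc zero))       = both-hold d<c
    table (suc (suc (suc zero))) (suc (suc (suc zero))) = both-fail ≤-refl

iso3241 : ∀ {a b c d} → d < b → b < a → a < c → OrderIso (a ∷ b ∷ c ∷ d ∷ []) p3241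
iso3241 {a} {b} {c} {d} d<b b<a a<c = refl , table
  where
    d<a = <-trans d<b b<a
    b<c = <-trans b<a a<c
    d<c = <-trans d<a a<c
    table : (i j : Fin 4) → _
    table zero                   zero                   = both-fail ≤-refl
    table zero                   (suc zero)             = both-fail (<⇒≤ b<a)
    table zero                   (suc (suc zero))       = both-hold a<c
    table zero                   (suc (suc (suc zero))) = both-fail (<⇒≤ d<a)
    table (suc zero)             zero                   = both-hold b<a
    table (suc zero)             (suc zero)             = both-fail ≤-refl
    table (suc zero)             (suc (suc zero))       = both-hold b<c
    table (suc zero)             (suc (suc (suc zero))) = both-fail (<⇒≤ d<b)
    table (suc (suc zero))       zero                   = both-fail (<⇒≤ a<c)
    table (suc (suc zero))       (suc zero)             = both-fail (<⇒≤ b<c)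
    table (suc (suc zero))       (suc (suc zero))       = both-fail ≤-refl
    table (suc (suc zero))       (suc (suc (suc zero))) = both-fail (<⇒≤ d<c)
    table (suc (suc (suc zero))) zero                   = both-hold d<a
    table (suc (suc (suc zero))) (suc zero)             = both-hold d<b
    table (suc (suc (suc zero))) (suc (suc zero))       = both-hold d<c
    table (suc (suc (suc zero))) (suc (suc (suc zero))) = both-fail ≤-refl

forbidden⇒contains : ∀ {π} → ForbiddenIn π → Contains π p3142 ⊎ Contains π p3241
forbidden⇒contains (occurs _ _ _ _ abcd (inj₁ (b<d , d<a , a<c))) = inj₁ (_ , abcd , iso3142 b<d d<a a<c)
forbidden⇒contains (occurs _ _ _ _ abcd (inj₂ (d<b , b<a , a<c))) = inj₂ (_ , abcd , iso3241 d<b b<a a<c)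

contains3142⇒forbidden : ∀ {π} → Contains π p3142 → ForbiddenIn π
contains3142⇒forbidden (a ∷ b ∷ c ∷ d ∷ [] , abcd , refl , table) =
  occurs a b c d abcd (inj₁ (Equivalence.from (table (# 1) (# 3)) (s≤s (s≤s z≤n))
                           , Equivalence.from (table (# 3) (# 0)) (s≤s (s≤s (s≤s z≤n)))
                           , Equivalence.from (table (# 0) (# 2)) (s≤s (s≤s (s≤s (s≤s z≤n))))))

contains3241⇒forbidden : ∀ {π} → Contains π p3241 → ForbiddenIn π
contains3241⇒forbidden (a ∷ b ∷ c ∷ d ∷ [] , abcd , refl , table) =
  occurs a b c d abcd (inj₂ (Equivalence.from (table (# 3) (# 1)) (s≤s (s≤s z≤n))
                           , Equivalence.from (table (# 1) (# 0)) (s≤s (s≤s (s≤s z≤n)))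
                           , Equivalence.from (table (# 0) (# 2)) (s≤s (s≤s (s≤s (s≤s z≤n))))))

-- At the initial state the pending word is π itself and I is empty, so the
-- only possible obstruction is an occurrence of 3142 or 3241 in π.
unobstructed⇔avoids : ∀ π → (¬ Obstructed (initial π)) ⇔ (Avoids π p3142 × Avoids π p3241)
unobstructed⇔avoids π = mk⇔ to from
  where
    to : ¬ Obstructed (initial π) → Avoids π p3142 × Avoids π p3241
    to unobstructed = unobstructed ∘ inj₁ ∘ contains3142⇒forbidden
                    , unobstructed ∘ inj₁ ∘ contains3241⇒forbidden
    from : Avoids π p3142 × Avoids π p3241 → ¬ Obstructed (initial π)
    from (avoids3142 , avoids3241) (inj₁ forbidden) = [ avoids3142 , avoids3241 ] (forbidden⇒contains forbidden)
    from _ (inj₂ (straddle _ _ _ () _ _ _))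

proposition2 : (π : List ℕ) → IsPerm π →
    SortedByAlgorithm π ⇔ (Avoids π p3142 × Avoids π p3241)
proposition2 π isPerm = unobstructed⇔avoids π ⇔-∘ sorted⇔unobstructed π isPerm
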